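{- A Tamari interval $I=(T,T')$ is synchronized, i.e. $\operatorname{can}(T)=\operatorname{can}(T')$, if and only if $\Phi(I)$ is synchronized, i.e. has no node incident to both a blue and a red half-edge (equivalently, at every node the two buds are consecutive in the cyclic order).
   Context: A binary tree is either a single leaf or a node with an ordered pair (left, right) of binary subtrees; size = number of nodes; $\mathcal{T}_n$ = binary trees of size $n$. The Tamari order on $\mathcal{T}_n$ is the reflexive-transitive closure of right rotations $((A,B),C)\mapsto(A,(B,C))$ on subtrees; a Tamari interval is $(T,T')$ with $T\le T'$. A leaf has canopy type $1$ if it is a left child, $0$ if a right child; $\operatorname{can}(T)$ is the word of leaf types from left to right. Label the nodes of $T$ as $v_1,\dots,v_n$ in infix order; $a_t(T)$, $b_t(T)$ are the sizes of the right and left subtrees of $v_t$. $\phi(T,T')$ is the arc-diagram on the points $0,\tfrac12,\dots,n$ (integers black, half-integers white) with, for each $t\in[n]$, an upper arc joining $t-\tfrac12$ to $t-1-b_t(T')$ and a lower arc joining $t-\tfrac12$ to $t+a_t(T)$. $\gamma$ turns it into a plane tree: vertices are the black points, the two arcs at each white point form a plain edge whose upper half-edge is blue and lower half-edge red, and each black point gets two buds (edges to new leaves), one pointing left and one pointing right along the axis. The result is a bicolored blossoming tree, whose nodes are the vertices of degree $\ge2$. $\Phi=\gamma\circ\phi$. -}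

module Defs where

open import Data.Nat using (ℕ; zero; suc; _+_; _∸_; _≤_)
open import Data.Bool using (Bool; true; false)
open import Data.List using (List; []; _∷_; _++_; [_]; map; upTo)
open import Data.List.Relation.Unary.Any using (Any)
open import Data.Product using (_×_; _,_; proj₁; proj₂)
open import Relation.Binary.PropositionalEquality using (_≡_)
open import Relation.Binary.Construct.Closure.ReflexiveTransitive using (Star)
open import Relation.Nullary using (¬_)

data Tree : Set where
  leaf : Tree
  node : Tree → Tree → Tree

size : Tree → ℕ
size leaf = 0
size (node l r) = suc (size l + size r)

data _⟶ʳ_ : Tree → Tree → Set where
  rot   : ∀ A B C → node (node A B) C ⟶ʳ node A (node B C)
  left  : ∀ {L L′} R → L ⟶ʳ L′ → node L R ⟶ʳ node L′ R
  right : ∀ L {R R′} → R ⟶ʳ R′ → node L R ⟶ʳ node L R′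

_≤T_ : Tree → Tree → Set
_≤T_ = Star _⟶ʳ_

-- Canopy: leaf types from left to right, true = 1 (left child), false = 0 (right child).
-- `canSub b T` lists leaf types of a subtree T that is a b-child.
canSub : Bool → Tree → List Bool
canSub b leaf = [ b ]
canSub b (node l r) = canSub true l ++ canSub false r

can : Tree → List Bool
can leaf = []            -- the lone root leaf is no child; irrelevant (size 0)
can (node l r) = canSub true l ++ canSub false r

infixData : Tree → List (ℕ × ℕ)
infixData leaf = []
infixData (node l r) = infixData l ++ (size l , size r) ∷ infixData r

-- t-th element (1-based), default (0,0) outside [1..length]
nth : List (ℕ × ℕ) → ℕ → ℕ × ℕ
nth [] _ = (0 , 0)
nth (x ∷ xs) zero = (0 , 0)
nth (x ∷ xs) (suc zero) = x
nth (x ∷ xs) (suc (suc t)) = nth xs (suc t)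

a : ℕ → Tree → ℕ
a t T = proj₂ (nth (infixData T) t)

b : ℕ → Tree → ℕ
b t T = proj₁ (nth (infixData T) t)

-- Bicolored blossoming tree of the shape produced by γ: black vertices 0..n,
-- each carrying two buds (so every black vertex is a node, degree ≥ 2), and
-- plain edges given as (endpoint of blue half-edge , endpoint of red half-edge).
record BlossomingTree : Set where
  constructor mkBT
  field
    nBlack : ℕ
    edges  : List (ℕ × ℕ)

open BlossomingTree public

-- φ then γ: for each t ∈ [n], the white point t-1/2 becomes a plain edge whose
-- upper (blue) half-edge ends at t-1-b_t(T') and lower (red) half-edge at t+a_t(T).
Φ : Tree → Tree → BlossomingTree
Φ T T′ = mkBT n (map (λ i → let t = suc i in ((t ∸ 1) ∸ b t T′ , t + a t T)) (upTo n))
  where n = size T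

IncidentBlue : BlossomingTree → ℕ → Set
IncidentBlue B u = Any (λ e → proj₁ e ≡ u) (edges B)

IncidentRed : BlossomingTree → ℕ → Set
IncidentRed B u = Any (λ e → proj₂ e ≡ u) (edges B)

-- Synchronized blossoming tree: no node incident to both a blue and a red half-edge.
-- (Nodes are exactly the black vertices 0..nBlack; bud leaves carry no colour.)
SynchronizedBT : BlossomingTree → Set
SynchronizedBT B = ∀ u → u ≤ nBlack B → ¬ (IncidentBlue B u × IncidentRed B u)

SynchronizedInterval : Tree → Tree → Set
SynchronizedInterval T T′ = can T ≡ can T′

module Submission where

-- The lower (red) arc of the t-th node of T ends at t + a_t(T), the position of the
-- rightmost leaf of its subtree, which is a right child; conversely every right-child
-- leaf is the rightmost leaf of its parent's subtree.  So the red half-edges of Φ(T,T′)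
-- end exactly at the 0-positions of can(T), and symmetrically the blue ones exactly at
-- the 1-positions of can(T′).  A right rotation can only turn 0s of the canopy into 1s,
-- so can(T) ≤ can(T′) pointwise; hence the two canopies agree iff no position is 0 in
-- can(T) and 1 in can(T′), i.e. iff no node of Φ(T,T′) sees both colours.

open import Defs
open import Data.Nat using (ℕ; suc; _+_; _∸_; _<_; z≤n; s≤s)
open import Data.Nat.Properties using (+-suc; +-assoc; +-identityʳ; m+n∸n≡m; ≤-pred)
open import Data.Bool.Base using (true; false; f≤t; b≤b) renaming (_≤_ to _≤ᴮ_)
import Data.Bool.Properties as Bool
open import Data.List using (List; []; _∷_; _++_; map; applyUpTo; length)
open import Data.List.Properties using (length-++; map-applyUpTo; ++-assoc)
open import Data.List.Membership.Propositional using (_∈_)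
open import Data.List.Relation.Unary.Any as Any using (here; there)
import Data.List.Relation.Unary.Any.Properties as Any
open import Data.List.Relation.Binary.Pointwise as Pointwise using (Pointwise; []; _∷_)
open import Data.Product using (_×_; _,_; proj₁; proj₂; ∃-syntax)
open import Data.Sum using (_⊎_; inj₁; inj₂)
open import Function using (_∘_; case_of_)
open import Function.Bundles using (_⇔_; mk⇔; Equivalence)
open import Function.Construct.Composition using (_⇔-∘_)
open import Relation.Binary.PropositionalEquality
  using (_≡_; refl; sym; trans; cong; cong₂; subst; module ≡-Reasoning)
import Relation.Binary.Construct.Closure.ReflexiveTransitive as Star
open import Relation.Nullary using (¬_)

open Equivalence

private
  variable
    A B : Set

-- Positions in lists are counted from 0, unlike the 1-based `nth`.

infix 4 _[_]=_

data _[_]=_ {A : Set} : List A → ℕ → A → Set where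
  here  : ∀ {x xs} → x ∷ xs [ 0 ]= x
  there : ∀ {x xs i y} → xs [ i ]= y → x ∷ xs [ suc i ]= y

[]=-injective : ∀ {xs : List A} {i x y} → xs [ i ]= x → xs [ i ]= y → x ≡ y
[]=-injective here      here      = refl
[]=-injective (there p) (there q) = []=-injective p q

[]=⇒<length : ∀ {xs : List A} {i x} → xs [ i ]= x → i < length xs
[]=⇒<length here      = s≤s z≤n
[]=⇒<length (there p) = s≤s ([]=⇒<length p)

[]=-++ˡ : ∀ {xs : List A} {i x} ys → xs [ i ]= x → xs ++ ys [ i ]= x
[]=-++ˡ ys here      = here
[]=-++ˡ ys (there p) = there ([]=-++ˡ ys p)

[]=-++ʳ : ∀ (xs : List A) {ys i y} → ys [ i ]= y → xs ++ ys [ length xs + i ]= y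
[]=-++ʳ []       p = p
[]=-++ʳ (x ∷ xs) p = there ([]=-++ʳ xs p)

[]=-++⁻ : ∀ (xs : List A) {ys i y} → xs ++ ys [ i ]= y →
          xs [ i ]= y ⊎ ∃[ j ] i ≡ length xs + j × ys [ j ]= y
[]=-++⁻ []       p         = inj₂ (_ , refl , p)
[]=-++⁻ (x ∷ xs) here      = inj₁ here
[]=-++⁻ (x ∷ xs) (there p) with []=-++⁻ xs p
... | inj₁ q           = inj₁ (there q)
... | inj₂ (j , e , q) = inj₂ (j , cong suc e , q)

pointwise-≡⇔no-rise : ∀ {xs ys} → Pointwise _≤ᴮ_ xs ys →
                      xs ≡ ys ⇔ (∀ i → ¬ (ys [ i ]= true × xs [ i ]= false))
pointwise-≡⇔no-rise xs≤ys = mk⇔ (λ { refl i (p , q) → true≢false ([]=-injective p q) }) (equal xs≤ys)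
  where
  true≢false : ¬ (true ≡ false)
  true≢false ()

  equal : ∀ {xs ys} → Pointwise _≤ᴮ_ xs ys → (∀ i → ¬ (ys [ i ]= true × xs [ i ]= false)) → xs ≡ ys
  equal []            noRise = refl
  equal (f≤t ∷ _)     noRise with () ← noRise 0 (here , here)
  equal (b≤b ∷ xs≤ys) noRise = cong (_ ∷_) (equal xs≤ys λ i (p , q) → noRise (suc i) (there p , there q))

length-canSub : ∀ c T → length (canSub c T) ≡ suc (size T)
length-canSub c leaf       = refl
length-canSub c (node l r) = begin
  length (canSub true l ++ canSub false r)          ≡⟨ length-++ (canSub true l) ⟩
  length (canSub true l) + length (canSub false r)  ≡⟨ cong₂ _+_ (length-canSub true l) (length-canSub false r) ⟩
  suc (size l) + suc (size r)                       ≡⟨ cong suc (+-suc (size l) (size r)) ⟩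
  suc (size (node l r))                             ∎
  where open ≡-Reasoning

canSub-node-right : ∀ c l r {i y} → canSub false r [ i ]= y →
                    canSub c (node l r) [ suc (size l) + i ]= y
canSub-node-right c l r {i} p =
  subst (λ m → canSub c (node l r) [ m + i ]= _) (length-canSub true l) ([]=-++ʳ (canSub true l) p)

canSub-node⁻ : ∀ c l r {i y} → canSub c (node l r) [ i ]= y →
               canSub true l [ i ]= y ⊎ ∃[ j ] i ≡ suc (size l) + j × canSub false r [ j ]= y
canSub-node⁻ c l r p with []=-++⁻ (canSub true l) p
... | inj₁ q           = inj₁ q
... | inj₂ (j , e , q) = inj₂ (j , trans e (cong (_+ j) (length-canSub true l)) , q)

canSub-true-head : ∀ T → canSub true T [ 0 ]= true
canSub-true-head leaf       = here
canSub-true-head (node l r) = []=-++ˡ _ (canSub-true-head l)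

canSub-false-last : ∀ T → canSub false T [ size T ]= false
canSub-false-last leaf       = here
canSub-false-last (node l r) = canSub-node-right false l r (canSub-false-last r)

canSub-false≤true : ∀ T → Pointwise _≤ᴮ_ (canSub false T) (canSub true T)
canSub-false≤true leaf       = f≤t ∷ []
canSub-false≤true (node l r) = Pointwise.refl Bool.≤-refl

canSub-mono-⟶ʳ : ∀ {X Y} → X ⟶ʳ Y → ∀ c → Pointwise _≤ᴮ_ (canSub c X) (canSub c Y)
canSub-mono-⟶ʳ (rot A B C) c =
  subst (λ xs → Pointwise _≤ᴮ_ xs (canSub true A ++ canSub true B ++ canSub false C))
    (sym (++-assoc (canSub true A) (canSub false B) (canSub false C)))
    (Pointwise.++⁺ˡ Bool.≤-refl (canSub true A)
      (Pointwise.++⁺ʳ Bool.≤-refl (canSub false C) (canSub-false≤true B)))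
canSub-mono-⟶ʳ (left R p)  c = Pointwise.++⁺ʳ Bool.≤-refl _ (canSub-mono-⟶ʳ p true)
canSub-mono-⟶ʳ (right L p) c = Pointwise.++⁺ˡ Bool.≤-refl _ (canSub-mono-⟶ʳ p false)

canSub-mono : ∀ {X Y} → X ≤T Y → ∀ c → Pointwise _≤ᴮ_ (canSub c X) (canSub c Y)
canSub-mono = Star.fold (λ X Y → ∀ c → Pointwise _≤ᴮ_ (canSub c X) (canSub c Y))
  (λ X⟶Y Y≤Z c → Pointwise.transitive Bool.≤-trans (canSub-mono-⟶ʳ X⟶Y c) (Y≤Z c))
  (λ c → Pointwise.refl Bool.≤-refl)

-- Arc endpoints listed along the infix order of the nodes; `nodeEnd k sₗ sᵣ` is the
-- endpoint of a node whose subtree starts at leaf position k and has subtrees of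
-- sizes sₗ and sᵣ (its infix index is then suc (k + sₗ)).

arcEnds : (ℕ → ℕ → ℕ → ℕ) → ℕ → Tree → List ℕ
arcEnds nodeEnd k leaf       = []
arcEnds nodeEnd k (node l r) =
  arcEnds nodeEnd k l ++ nodeEnd k (size l) (size r) ∷ arcEnds nodeEnd (suc (k + size l)) r

redEnds : ℕ → Tree → List ℕ
redEnds = arcEnds (λ k sₗ sᵣ → suc (k + sₗ) + sᵣ)

blueEnds : ℕ → Tree → List ℕ
blueEnds = arcEnds (λ k _ _ → k)

shift-+ : ∀ k m j → suc (k + m) + j ≡ k + (suc m + j)
shift-+ k m j = trans (cong suc (+-assoc k m j)) (sym (+-suc k (m + j)))

redEnds-sound : ∀ {u} k T c → u ∈ redEnds k T → ∃[ i ] u ≡ k + i × canSub c T [ i ]= false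
redEnds-sound k (node l r) c p with Any.++⁻ (redEnds k l) p
... | inj₁ q with redEnds-sound k l true q
...   | i , e , a = i , e , []=-++ˡ _ a
redEnds-sound k (node l r) c p | inj₂ (here e) =
  _ , trans e (shift-+ k (size l) (size r)) , canSub-node-right c l r (canSub-false-last r)
redEnds-sound k (node l r) c p | inj₂ (there q) with redEnds-sound (suc (k + size l)) r false q
... | j , e , a = _ , trans e (shift-+ k (size l) j) , canSub-node-right c l r a

redEnds-complete : ∀ k l r c {i} → canSub c (node l r) [ i ]= false → k + i ∈ redEnds k (node l r)
redEnds-complete k l r c a with canSub-node⁻ c l r a
redEnds-complete k leaf         r c a | inj₁ (there ())
redEnds-complete k (node ll lr) r c a | inj₁ b = Any.++⁺ˡ (redEnds-complete k ll lr true b)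
redEnds-complete k l leaf c a | inj₂ (.0 , refl , here) =
  Any.++⁺ʳ (redEnds k l) (here (sym (shift-+ k (size l) 0)))
redEnds-complete k l (node rl rr) c a | inj₂ (j , refl , b) =
  Any.++⁺ʳ (redEnds k l) (there (subst (_∈ redEnds (suc (k + size l)) (node rl rr)) (shift-+ k (size l) j)
    (redEnds-complete (suc (k + size l)) rl rr false b)))

blueEnds-sound : ∀ {u} k T c → u ∈ blueEnds k T → ∃[ i ] u ≡ k + i × canSub c T [ i ]= true
blueEnds-sound k (node l r) c p with Any.++⁻ (blueEnds k l) p
... | inj₁ q with blueEnds-sound k l true q
...   | i , e , a = i , e , []=-++ˡ _ a
blueEnds-sound k (node l r) c p | inj₂ (here e) =
  0 , trans e (sym (+-identityʳ k)) , []=-++ˡ _ (canSub-true-head l)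
blueEnds-sound k (node l r) c p | inj₂ (there q) with blueEnds-sound (suc (k + size l)) r false q
... | j , e , a = _ , trans e (shift-+ k (size l) j) , canSub-node-right c l r a

blueEnds-complete : ∀ k l r c {i} → canSub c (node l r) [ i ]= true → k + i ∈ blueEnds k (node l r)
blueEnds-complete k l r c a with canSub-node⁻ c l r a
blueEnds-complete k leaf         r c a | inj₁ here = here (+-identityʳ k)
blueEnds-complete k (node ll lr) r c a | inj₁ b    = Any.++⁺ˡ (blueEnds-complete k ll lr true b)
blueEnds-complete k l leaf         c a | inj₂ (_ , _ , there ())
blueEnds-complete k l (node rl rr) c a | inj₂ (j , refl , b) =
  Any.++⁺ʳ (blueEnds k l) (there (subst (_∈ blueEnds (suc (k + size l)) (node rl rr)) (shift-+ k (size l) j)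
    (blueEnds-complete (suc (k + size l)) rl rr false b)))

indexedMap : (ℕ → A → B) → ℕ → List A → List B
indexedMap g k []       = []
indexedMap g k (x ∷ xs) = g k x ∷ indexedMap g (suc k) xs

indexedMap-++ : ∀ (g : ℕ → A → B) k xs ys →
                indexedMap g k (xs ++ ys) ≡ indexedMap g k xs ++ indexedMap g (k + length xs) ys
indexedMap-++ g k []       ys = cong (λ m → indexedMap g m ys) (sym (+-identityʳ k))
indexedMap-++ g k (x ∷ xs) ys =
  cong (g k x ∷_) (trans (indexedMap-++ g (suc k) xs ys)
                         (cong (λ m → indexedMap g (suc k) xs ++ indexedMap g m ys) (sym (+-suc k (length xs)))))

indexedMap-∘suc : ∀ (g : ℕ → A → B) k xs → indexedMap (g ∘ suc) k xs ≡ indexedMap g (suc k) xs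
indexedMap-∘suc g k []       = refl
indexedMap-∘suc g k (x ∷ xs) = cong (g (suc k) x ∷_) (indexedMap-∘suc g (suc k) xs)

applyUpTo-nth : ∀ (g : ℕ → ℕ × ℕ → ℕ) xs →
                applyUpTo (λ i → g (suc i) (nth xs (suc i))) (length xs) ≡ indexedMap g 1 xs
applyUpTo-nth g []       = refl
applyUpTo-nth g (x ∷ xs) =
  cong (g 1 x ∷_) (trans (applyUpTo-nth (g ∘ suc) xs) (indexedMap-∘suc g 1 xs))

length-infixData : ∀ T → length (infixData T) ≡ size T
length-infixData leaf       = refl
length-infixData (node l r) = begin
  length (infixData l ++ (size l , size r) ∷ infixData r)  ≡⟨ length-++ (infixData l) ⟩
  length (infixData l) + suc (length (infixData r))        ≡⟨ cong₂ (λ m n → m + suc n) (length-infixData l) (length-infixData r) ⟩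
  size l + suc (size r)                                    ≡⟨ +-suc (size l) (size r) ⟩
  size (node l r)                                          ∎
  where open ≡-Reasoning

indexedMap-infixData : ∀ (g : ℕ → ℕ × ℕ → ℕ) nodeEnd →
                       (∀ k sₗ sᵣ → g (suc (k + sₗ)) (sₗ , sᵣ) ≡ nodeEnd k sₗ sᵣ) →
                       ∀ k T → indexedMap g (suc k) (infixData T) ≡ arcEnds nodeEnd k T
indexedMap-infixData g nodeEnd g≡end k leaf       = refl
indexedMap-infixData g nodeEnd g≡end k (node l r) = begin
  indexedMap g (suc k) (infixData l ++ (size l , size r) ∷ infixData r)
    ≡⟨ indexedMap-++ g (suc k) (infixData l) _ ⟩
  indexedMap g (suc k) (infixData l) ++ indexedMap g (suc k + length (infixData l)) ((size l , size r) ∷ infixData r)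
    ≡⟨ cong₂ _++_ (recurse k l) (cong (λ m → indexedMap g (suc k + m) ((size l , size r) ∷ infixData r)) (length-infixData l)) ⟩
  arcEnds nodeEnd k l ++ g (suc (k + size l)) (size l , size r) ∷ indexedMap g (suc (suc (k + size l))) (infixData r)
    ≡⟨ cong (λ xs → arcEnds nodeEnd k l ++ xs) (cong₂ _∷_ (g≡end k (size l) (size r)) (recurse (suc (k + size l)) r)) ⟩
  arcEnds nodeEnd k (node l r) ∎
  where
  open ≡-Reasoning
  recurse = indexedMap-infixData g nodeEnd g≡end

map-edgesΦ : ∀ T T′ (g : ℕ × ℕ → ℕ) →
             map g (edges (Φ T T′)) ≡ applyUpTo (λ i → g ((suc i ∸ 1) ∸ b (suc i) T′ , suc i + a (suc i) T)) (size T)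
map-edgesΦ T T′ g = trans (cong (map g) (map-applyUpTo _ _ (size T))) (map-applyUpTo _ g (size T))

redEnds-Φ : ∀ T T′ → map proj₂ (edges (Φ T T′)) ≡ redEnds 0 T
redEnds-Φ T T′ = begin
  map proj₂ (edges (Φ T T′))
    ≡⟨ map-edgesΦ T T′ proj₂ ⟩
  applyUpTo (λ i → suc i + a (suc i) T) (size T)
    ≡⟨ cong (applyUpTo _) (sym (length-infixData T)) ⟩
  applyUpTo (λ i → suc i + a (suc i) T) (length (infixData T))
    ≡⟨ applyUpTo-nth (λ t p → t + proj₂ p) (infixData T) ⟩
  indexedMap (λ t p → t + proj₂ p) 1 (infixData T)
    ≡⟨ indexedMap-infixData _ _ (λ _ _ _ → refl) 0 T ⟩
  redEnds 0 T ∎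
  where open ≡-Reasoning

blueEnds-Φ : ∀ T T′ → size T ≡ size T′ → map proj₁ (edges (Φ T T′)) ≡ blueEnds 0 T′
blueEnds-Φ T T′ sizes≡ = begin
  map proj₁ (edges (Φ T T′))
    ≡⟨ map-edgesΦ T T′ proj₁ ⟩
  applyUpTo (λ i → i ∸ b (suc i) T′) (size T)
    ≡⟨ cong (applyUpTo _) (trans sizes≡ (sym (length-infixData T′))) ⟩
  applyUpTo (λ i → i ∸ b (suc i) T′) (length (infixData T′))
    ≡⟨ applyUpTo-nth (λ t p → (t ∸ 1) ∸ proj₁ p) (infixData T′) ⟩
  indexedMap (λ t p → (t ∸ 1) ∸ proj₁ p) 1 (infixData T′)
    ≡⟨ indexedMap-infixData _ _ (λ k sₗ _ → m+n∸n≡m k sₗ) 0 T′ ⟩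
  blueEnds 0 T′ ∎
  where open ≡-Reasoning

Any-map⇔∈ : ∀ {f : A → B} {xs ys u} → map f xs ≡ ys → Any.Any (λ x → f x ≡ u) xs ⇔ u ∈ ys
Any-map⇔∈ refl = mk⇔ (Any.map sym ∘ Any.map⁺) (Any.map⁻ ∘ Any.map sym)

∈redEnds⇔canopy-false : ∀ l r {u} → u ∈ redEnds 0 (node l r) ⇔ can (node l r) [ u ]= false
∈redEnds⇔canopy-false l r = mk⇔
  (λ p → case redEnds-sound 0 (node l r) true p of λ { (_ , refl , a) → a })
  (redEnds-complete 0 l r true)

∈blueEnds⇔canopy-true : ∀ l r {u} → u ∈ blueEnds 0 (node l r) ⇔ can (node l r) [ u ]= true
∈blueEnds⇔canopy-true l r = mk⇔
  (λ p → case blueEnds-sound 0 (node l r) true p of λ { (_ , refl , a) → a })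
  (blueEnds-complete 0 l r true)

incidentRed⇔canopy-false : ∀ l r T′ {u} → IncidentRed (Φ (node l r) T′) u ⇔ can (node l r) [ u ]= false
incidentRed⇔canopy-false l r T′ = ∈redEnds⇔canopy-false l r ⇔-∘ Any-map⇔∈ (redEnds-Φ (node l r) T′)

incidentBlue⇔canopy-true : ∀ T l r → size T ≡ size (node l r) → ∀ {u} →
                           IncidentBlue (Φ T (node l r)) u ⇔ can (node l r) [ u ]= true
incidentBlue⇔canopy-true T l r sizes≡ = ∈blueEnds⇔canopy-true l r ⇔-∘ Any-map⇔∈ (blueEnds-Φ T (node l r) sizes≡)

corollary4p6 : (n : ℕ) (T T′ : Tree) → size T ≡ n → size T′ ≡ n → T ≤T T′ →
    (SynchronizedInterval T T′ ⇔ SynchronizedBT (Φ T T′))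
corollary4p6 n leaf leaf _ _ _ = mk⇔ (λ _ _ _ ()) (λ _ → refl)
corollary4p6 n leaf (node _ _) refl () _
corollary4p6 n (node _ _) leaf refl () _
corollary4p6 n T@(node l r) T′@(node l′ r′) size≡n size′≡n T≤T′ = mk⇔
  (λ can≡ u _ (blue , red) → to noRise can≡ u (Blue.to blue , Red.to red))
  (λ sync → from noRise λ u (blue , red) →
    sync u (≤-pred (subst (u <_) (length-canSub true T) ([]=⇒<length red))) (Blue.from blue , Red.from red))
  where
  noRise = pointwise-≡⇔no-rise (canSub-mono T≤T′ true)
  module Red {u} = Equivalence (incidentRed⇔canopy-false l r T′ {u})
  module Blue {u} = Equivalence (incidentBlue⇔canopy-true T l′ r′ (trans size≡n (sym size′≡n)) {u})
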